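{- Let $k,n$ be integers with $0\le k\le n$. If $\mathcal{F}\subseteq 2^{[n]}$ is such that the vertex set of each component of $G_\mathcal{F}$ is a diamond of height at most $k$, then \[ |\mathcal{F}|\le 2^k\binom{n-k}{\lfloor (n-k)/2\rfloor}. \]
   Context: For $\mathcal{F}\subseteq 2^{[n]}$, $G_\mathcal{F}$ is the graph on $\mathcal{F}$ with distinct $A,B$ adjacent iff $A\subseteq B$ or $B\subseteq A$. A diamond is a family $\{X: A\subseteq X\subseteq B\}$ for some $A\subseteq B\subseteq[n]$; its height is $|B|-|A|$. -}

module Defs where

open import Data.Nat using (ℕ; _∸_; _≤_)
open import Data.Fin.Subset using (Subset; _⊆_; ∣_∣)
open import Data.List using (List)
open import Data.List.Membership.Propositional using (_∈_)
open import Data.Product using (Σ; _×_; ∃₂)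
open import Data.Sum using (_⊎_)
open import Relation.Binary.PropositionalEquality using (_≢_)
open import Relation.Binary.Construct.Closure.ReflexiveTransitive using (Star)
open import Function.Bundles using (_⇔_)

-- A family F ⊆ 2^[n] is represented as a duplicate-free list of subsets
-- (duplicate-freeness is imposed in the statement); |F| = length.

-- Edge of the comparability graph G_F: distinct A, B in F with A ⊆ B or B ⊆ A.
record Adj {n : ℕ} (F : List (Subset n)) (A B : Subset n) : Set where
  constructor adj
  field
    A∈F : A ∈ F
    B∈F : B ∈ F
    A≢B : A ≢ B
    comparable : A ⊆ B ⊎ B ⊆ A

-- B lies in the same component of G_F as A (A ∈ F assumed separately).
Connected : {n : ℕ} → List (Subset n) → Subset n → Subset n → Set
Connected F = Star (Adj F)

InDiamond : {n : ℕ} → Subset n → Subset n → Subset n → Set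
InDiamond A B X = A ⊆ X × X ⊆ B

height : {n : ℕ} → Subset n → Subset n → ℕ
height A B = ∣ B ∣ ∸ ∣ A ∣

ComponentIsDiamond : {n : ℕ} → ℕ → List (Subset n) → Subset n → Set
ComponentIsDiamond {n} k F C =
  Σ (Subset n) λ A → Σ (Subset n) λ B →
    A ⊆ B × height A B ≤ k ×
    ((X : Subset n) → (X ∈ F × Connected F C X) ⇔ InDiamond A B X)

-- Each component of G_F is a diamond, and distinct components are separated: no member
-- of one is contained in a member of the other, since comparable sets are adjacent. So no
-- maximal chain ∅ ⊂ {x₁} ⊂ … ⊂ [n] meets two of the diamonds. A diamond with bottom of size
-- a and height h is met by exactly n! / C(n−h, a) maximal chains, which gives the LYM-type
-- inequality Σ 1 / C(n−h, a) ≤ 1 over the components. As C(n−h, a) ≤ C(n−h, ⌊(n−h)/2⌋) and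
-- 2^h C(n−h, ⌊(n−h)/2⌋) ≤ 2^k C(n−k, ⌊(n−k)/2⌋) for h ≤ k, each component has at most
-- 2^k C(n−k, ⌊(n−k)/2⌋) / C(n−h, a) members, and summing gives the bound. Instead of counting
-- chains as permutations, the LYM inequality is proved by induction on the chains starting
-- at a set S, splitting them according to the first element they add to S.

module Submission where

open import Defs
open import Data.Bool using (true; false; if_then_else_)
import Data.Bool.Properties as Bool
open import Data.Empty using (⊥-elim)
open import Data.Fin using (Fin; zero; suc)
open import Data.Fin.Subset using (Subset; _⊆_; ∣_∣; _─_; ⊥; ⊤)
open import Data.Fin.Subset.Properties using (drop-∷-⊆; p─⊥≡p; ⊆-refl; ⊆-antisym)
open import Data.List using (List; []; _∷_; map; _++_; length; concatMap; deduplicate)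
open import Data.List.Properties using (length-++; length-map; length-++-sucʳ)
open import Data.List.Membership.Propositional using (_∈_; find; lose; mapWith∈)
open import Data.List.Membership.Propositional.Properties
  using (∈-map⁺; ∈-++⁺ˡ; ∈-++⁺ʳ; ∈-++⁻; ∈-∃++; ∈-concatMap⁺; ∈-deduplicate⁺; ∈-deduplicate⁻)
open import Data.List.Relation.Unary.All as All using (All; []; _∷_)
open import Data.List.Relation.Unary.All.Properties using (¬Any⇒All¬)
open import Data.List.Relation.Unary.AllPairs using (AllPairs; []; _∷_)
open import Data.List.Relation.Unary.Any using (here; there; any?)
open import Data.List.Relation.Unary.Any.Properties using (mapWith∈⁺; mapWith∈⁻)
open import Data.List.Relation.Unary.Unique.Propositional using (Unique)
open import Data.List.Relation.Unary.Unique.DecPropositional.Properties using (deduplicate-!)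
open import Data.Nat
open import Data.Nat.Properties
open import Data.Nat.Combinatorics using (_C_; nCk+nC[k+1]≡[n+1]C[k+1])
open import Data.Nat.DivMod using (m≡m%n+[m/n]*n; m%n<n; m/n*n≤m)
open import Data.Nat.ListAction using () renaming (sum to sumˡ)
open import Data.Nat.Tactic.RingSolver using (solve-∀)
open import Data.Product using (_×_; _,_; proj₁; proj₂; ∃₂; uncurry)
import Data.Product.Properties as Product
open import Data.Sum using (inj₁; inj₂)
import Data.Sum as Sum
open import Data.Vec using ([]; _∷_; lookup; _[_]≔_; here; there)
open import Data.Vec.Properties using ([]≔-lookup; lookup-replicate)
import Data.Vec.Properties as Vec
open import Algebra.Properties.CommutativeMonoid.Sum +-0-commutativeMonoid
  using (sum; sum-syntax; ∑-distrib-+; sum-cong-≗; sum-replicate-zero)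
open import Algebra.Properties.CommutativeSemigroup +-commutativeSemigroup
  using () renaming (x∙yz≈y∙xz to m+[n+o]≡n+[m+o])
open import Algebra.Properties.CommutativeSemigroup *-commutativeSemigroup
  using () renaming (x∙yz≈y∙xz to m*[n*o]≡n*[m*o])
open import Function using (_∘′_)
open import Function.Bundles using (Equivalence; _⇔_)
open import Relation.Binary.Construct.Closure.ReflexiveTransitive using (ε; _◅_; _◅◅_; reverse)
open import Relation.Binary.Definitions using (DecidableEquality)
open import Relation.Binary.PropositionalEquality
open import Relation.Nullary using (¬_; yes; no)

binomial : ℕ → ℕ → ℕ
binomial n       zero    = 1
binomial zero    (suc k) = 0
binomial (suc n) (suc k) = binomial n k + binomial n (suc k)

binomial≡C : ∀ n k → binomial n k ≡ n C k
binomial≡C n       zero    = refl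
binomial≡C zero    (suc k) = refl
binomial≡C (suc n) (suc k) =
  trans (cong₂ _+_ (binomial≡C n k) (binomial≡C n (suc k))) (nCk+nC[k+1]≡[n+1]C[k+1] n k)

binomial-vanishes : ∀ n k → n < k → binomial n k ≡ 0
binomial-vanishes zero    (suc k) _         = refl
binomial-vanishes (suc n) (suc k) (s≤s n<k) =
  cong₂ _+_ (binomial-vanishes n k n<k) (binomial-vanishes n (suc k) (m<n⇒m<1+n n<k))

binomial-1 : ∀ n → binomial n 1 ≡ n
binomial-1 zero    = refl
binomial-1 (suc n) = cong suc (binomial-1 n)

-- Truncated subtraction is harmless here, since binomial n k = 0 for k > n.
*binomial-cong : ∀ {a b} n k → (k ≤ n → a ≡ b) → a * binomial n k ≡ b * binomial n k
*binomial-cong {a} {b} n k a≡b with k ≤? n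
... | yes k≤n = cong (_* binomial n k) (a≡b k≤n)
... | no  k≰n rewrite binomial-vanishes n k (≰⇒> k≰n) = trans (*-zeroʳ a) (sym (*-zeroʳ b))

binomial-ratio : ∀ n k → suc k * binomial n (suc k) ≡ (n ∸ k) * binomial n k
binomial-ratio zero    zero    = refl
binomial-ratio zero    (suc k) = *-zeroʳ (2 + k)
binomial-ratio (suc n) zero    =
  cong suc (trans (+-identityʳ _) (trans (binomial-1 n) (sym (*-identityʳ n))))
binomial-ratio (suc n) (suc k) = begin
  (2 + k) * (binomial n (suc k) + binomial n (2 + k))
    ≡⟨ *-distribˡ-+ (2 + k) (binomial n (suc k)) (binomial n (2 + k)) ⟩
  (2 + k) * binomial n (suc k) + (2 + k) * binomial n (2 + k)
    ≡⟨ cong ((2 + k) * binomial n (suc k) +_) (binomial-ratio n (suc k)) ⟩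
  (2 + k) * binomial n (suc k) + (n ∸ suc k) * binomial n (suc k)
    ≡⟨ regroup (suc k) (n ∸ suc k) (binomial n (suc k)) ⟩
  suc k * binomial n (suc k) + suc (n ∸ suc k) * binomial n (suc k)
    ≡⟨ cong₂ _+_ (binomial-ratio n k) (*binomial-cong n (suc k) (λ k<n → sym (+-∸-assoc 1 k<n))) ⟩
  (n ∸ k) * binomial n k + (n ∸ k) * binomial n (suc k)
    ≡⟨ *-distribˡ-+ (n ∸ k) (binomial n k) (binomial n (suc k)) ⟨
  (n ∸ k) * (binomial n k + binomial n (suc k)) ∎
  where
  open ≡-Reasoning
  regroup : ∀ a b x → suc a * x + b * x ≡ a * x + suc b * x
  regroup = solve-∀

binomial-absorption : ∀ n k → suc k * binomial (suc n) (suc k) ≡ suc n * binomial n k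
binomial-absorption n k = begin
  suc k * (binomial n k + binomial n (suc k))
    ≡⟨ *-distribˡ-+ (suc k) (binomial n k) (binomial n (suc k)) ⟩
  suc k * binomial n k + suc k * binomial n (suc k)
    ≡⟨ cong (suc k * binomial n k +_) (binomial-ratio n k) ⟩
  suc k * binomial n k + (n ∸ k) * binomial n k
    ≡⟨ *-distribʳ-+ (binomial n k) (suc k) (n ∸ k) ⟨
  suc (k + (n ∸ k)) * binomial n k
    ≡⟨ *binomial-cong n k (cong suc ∘′ m+[n∸m]≡n) ⟩
  suc n * binomial n k ∎
  where open ≡-Reasoning

binomial-increasing : ∀ n k → k + suc k ≤ n → binomial n k ≤ binomial n (suc k)
binomial-increasing n k 2k+1≤n = *-cancelˡ-≤ (suc k) (begin
  suc k * binomial n k       ≤⟨ *-monoˡ-≤ (binomial n k) (m+n≤o⇒m≤o∸n (suc k) (≤-trans (≤-reflexive (+-comm (suc k) k)) 2k+1≤n)) ⟩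
  (n ∸ k) * binomial n k     ≡⟨ binomial-ratio n k ⟨
  suc k * binomial n (suc k) ∎)
  where open ≤-Reasoning

binomial-decreasing : ∀ n k → n ≤ k + suc k → binomial n (suc k) ≤ binomial n k
binomial-decreasing n k n≤2k+1 = *-cancelˡ-≤ (suc k) (begin
  suc k * binomial n (suc k) ≡⟨ binomial-ratio n k ⟩
  (n ∸ k) * binomial n k     ≤⟨ *-monoˡ-≤ (binomial n k) (m≤n+o⇒m∸n≤o n k n≤2k+1) ⟩
  suc k * binomial n k       ∎)
  where open ≤-Reasoning

ascending : ∀ (f : ℕ → ℕ) {i j} → (∀ {m} → i ≤ m → m < j → f m ≤ f (suc m)) → i ≤ j → f i ≤ f j
ascending f {j = zero}  step z≤n = ≤-refl
ascending f {j = suc j} step i≤1+j with m≤n⇒m<n∨m≡n i≤1+j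
... | inj₂ refl = ≤-refl
... | inj₁ (s≤s i≤j) =
  ≤-trans (ascending f (λ i≤m m<j → step i≤m (m<n⇒m<1+n m<j)) i≤j) (step i≤j ≤-refl)

descending : ∀ (f : ℕ → ℕ) {i j} → (∀ {m} → i ≤ m → m < j → f (suc m) ≤ f m) → i ≤ j → f j ≤ f i
descending f {j = zero}  step z≤n = ≤-refl
descending f {j = suc j} step i≤1+j with m≤n⇒m<n∨m≡n i≤1+j
... | inj₂ refl = ≤-refl
... | inj₁ (s≤s i≤j) =
  ≤-trans (step i≤j ≤-refl) (descending f (λ i≤m m<j → step i≤m (m<n⇒m<1+n m<j)) i≤j)

half+half≤ : ∀ n → n / 2 + n / 2 ≤ n
half+half≤ n = begin
  n / 2 + n / 2 ≡⟨ cong (n / 2 +_) (+-identityʳ (n / 2)) ⟨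
  2 * (n / 2)   ≡⟨ *-comm 2 (n / 2) ⟩
  n / 2 * 2     ≤⟨ m/n*n≤m n 2 ⟩
  n             ∎
  where open ≤-Reasoning

≤1+half+half : ∀ n → n ≤ suc (n / 2 + n / 2)
≤1+half+half n = begin
  n                   ≡⟨ m≡m%n+[m/n]*n n 2 ⟩
  n % 2 + n / 2 * 2   ≤⟨ +-monoˡ-≤ (n / 2 * 2) (≤-pred (m%n<n n 2)) ⟩
  1 + n / 2 * 2       ≡⟨ cong suc (trans (*-comm (n / 2) 2) (cong (n / 2 +_) (+-identityʳ (n / 2)))) ⟩
  suc (n / 2 + n / 2) ∎
  where open ≤-Reasoning

central : ℕ → ℕ
central n = binomial n (n / 2)

binomial≤central : ∀ n k → binomial n k ≤ central n
binomial≤central n k with k ≤? n / 2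
... | yes k≤h = ascending (binomial n) (λ _ m<h → binomial-increasing n _ (below m<h)) k≤h
  where
  below : ∀ {m} → m < n / 2 → m + suc m ≤ n
  below m<h = ≤-trans (+-mono-≤ (<⇒≤ m<h) m<h) (half+half≤ n)
... | no  k≰h = descending (binomial n) (λ h≤m _ → binomial-decreasing n _ (above h≤m)) (≰⇒≥ k≰h)
  where
  above : ∀ {m} → n / 2 ≤ m → n ≤ m + suc m
  above {m} h≤m = begin
    n                   ≤⟨ ≤1+half+half n ⟩
    suc (n / 2 + n / 2) ≡⟨ +-suc (n / 2) (n / 2) ⟨
    n / 2 + suc (n / 2) ≤⟨ +-mono-≤ h≤m (s≤s h≤m) ⟩
    m + suc m           ∎
    where open ≤-Reasoning

central-suc : ∀ n → central (suc n) ≤ 2 * central n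
central-suc n with suc n / 2
... | zero  = ≤-trans (binomial≤central n 0) (m≤m+n (central n) (central n + 0))
... | suc k = begin
  binomial n k + binomial n (suc k) ≤⟨ +-mono-≤ (binomial≤central n k) (binomial≤central n (suc k)) ⟩
  central n + central n             ≡⟨ cong (central n +_) (+-identityʳ (central n)) ⟨
  2 * central n                     ∎
  where open ≤-Reasoning

2^k*central[n∸k]-mono : ∀ {n h k} → h ≤ k → k ≤ n → 2 ^ h * central (n ∸ h) ≤ 2 ^ k * central (n ∸ k)
2^k*central[n∸k]-mono {n} {h} {k} h≤k k≤n = ascending (λ i → 2 ^ i * central (n ∸ i)) step h≤k
  where
  step : ∀ {m} → h ≤ m → m < k → 2 ^ m * central (n ∸ m) ≤ 2 ^ suc m * central (n ∸ suc m)
  step {m} _ m<k = begin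
    2 ^ m * central (n ∸ m)                ≡⟨ cong (λ i → 2 ^ m * central i) (+-∸-assoc 1 (≤-trans m<k k≤n)) ⟩
    2 ^ m * central (suc (n ∸ suc m))      ≤⟨ *-monoʳ-≤ (2 ^ m) (central-suc (n ∸ suc m)) ⟩
    2 ^ m * (2 * central (n ∸ suc m))      ≡⟨ *-assoc (2 ^ m) 2 _ ⟨
    2 ^ m * 2 * central (n ∸ suc m)        ≡⟨ cong (_* central (n ∸ suc m)) (*-comm (2 ^ m) 2) ⟩
    2 ^ suc m * central (n ∸ suc m)        ∎
    where open ≤-Reasoning

-- The number of maximal chains of 2^[m] that meet a fixed diamond whose bottom has a elements
-- and whose height is h. A chain meets it at once when a = 0; otherwise its first element lies
-- in the bottom (a choices), or in the rest of the top (h choices, leaving a diamond of height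
-- h − 1 above it), or outside the top, and then the chain misses the diamond.
meetingChains : ℕ → ℕ → ℕ → ℕ
meetingChains m       zero    h = m !
meetingChains zero    (suc a) h = 0
meetingChains (suc m) (suc a) h = suc a * meetingChains m a h + h * meetingChains m (suc a) (pred h)

meetingChains-cong : ∀ {m m′ a a′ h h′} → m ≡ m′ → a ≡ a′ → h ≡ h′ → meetingChains m a h ≡ meetingChains m′ a′ h′
meetingChains-cong refl refl refl = refl

meetingChains*binomial : ∀ m a h → a + h ≤ m → meetingChains m a h * binomial (m ∸ h) a ≡ m !
meetingChains*binomial m       zero    h _ = *-identityʳ (m !)
meetingChains*binomial (suc m) (suc a) h (s≤s a+h≤m) = begin
  (suc a * X + h * Y) * binomial (suc m ∸ h) (suc a)
    ≡⟨ cong (λ i → (suc a * X + h * Y) * binomial i (suc a)) (+-∸-assoc 1 h≤m) ⟩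
  (suc a * X + h * Y) * binomial (suc N) (suc a)
    ≡⟨ distribute (suc a) X h Y (binomial (suc N) (suc a)) ⟩
  X * (suc a * binomial (suc N) (suc a)) + h * (Y * binomial (suc N) (suc a))
    ≡⟨ cong₂ (λ u v → X * u + v) (binomial-absorption N a) (upper-part h a+h≤m) ⟩
  X * (suc N * binomial N a) + h * m !
    ≡⟨ cong (_+ h * m !) (m*[n*o]≡n*[m*o] X (suc N) (binomial N a)) ⟩
  suc N * (X * binomial N a) + h * m !
    ≡⟨ cong (λ u → suc N * u + h * m !) (meetingChains*binomial m a h a+h≤m) ⟩
  suc N * m ! + h * m !
    ≡⟨ *-distribʳ-+ (m !) (suc N) h ⟨
  suc (N + h) * m !
    ≡⟨ cong (λ i → suc i * m !) (m∸n+n≡m h≤m) ⟩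
  suc m * m ! ∎
  where
  open ≡-Reasoning
  X = meetingChains m a h
  Y = meetingChains m (suc a) (pred h)
  N = m ∸ h
  h≤m : h ≤ m
  h≤m = ≤-trans (m≤n+m h a) a+h≤m
  distribute : ∀ s x h y b → (s * x + h * y) * b ≡ x * (s * b) + h * (y * b)
  distribute = solve-∀
  upper-part : ∀ j → a + j ≤ m →
    j * (meetingChains m (suc a) (pred j) * binomial (suc (m ∸ j)) (suc a)) ≡ j * m !
  upper-part zero    _       = refl
  upper-part (suc j) a+j<m = cong (suc j *_) (begin
    meetingChains m (suc a) j * binomial (suc (m ∸ suc j)) (suc a)
      ≡⟨ cong (λ i → meetingChains m (suc a) j * binomial i (suc a)) (+-∸-assoc 1 (≤-trans (m≤n+m (suc j) a) a+j<m)) ⟨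
    meetingChains m (suc a) j * binomial (m ∸ j) (suc a)
      ≡⟨ meetingChains*binomial m (suc a) j (≤-trans (≤-reflexive (sym (+-suc a j))) a+j<m) ⟩
    m ! ∎)

2^h*m!≤bound*meetingChains : ∀ {m a h k} → a + h ≤ m → h ≤ k → k ≤ m →
  2 ^ h * m ! ≤ 2 ^ k * central (m ∸ k) * meetingChains m a h
2^h*m!≤bound*meetingChains {m} {a} {h} {k} a+h≤m h≤k k≤m = begin
  2 ^ h * m !                                   ≡⟨ cong (2 ^ h *_) (meetingChains*binomial m a h a+h≤m) ⟨
  2 ^ h * (X * binomial (m ∸ h) a)              ≤⟨ *-monoʳ-≤ (2 ^ h) (*-monoʳ-≤ X (binomial≤central (m ∸ h) a)) ⟩
  2 ^ h * (X * central (m ∸ h))                 ≡⟨ swap-factors (2 ^ h) X (central (m ∸ h)) ⟩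
  2 ^ h * central (m ∸ h) * X                   ≤⟨ *-monoˡ-≤ X (2^k*central[n∸k]-mono h≤k k≤m) ⟩
  2 ^ k * central (m ∸ k) * X                   ∎
  where
  open ≤-Reasoning
  X = meetingChains m a h
  swap-factors : ∀ x y z → x * (y * z) ≡ x * z * y
  swap-factors = solve-∀

-- Inclusion as an inductive family, so that proofs can recurse on it.
infix 4 _⊑_

data _⊑_ : ∀ {n} → Subset n → Subset n → Set where
  []    : [] ⊑ []
  out∷_ : ∀ {n b} {X Y : Subset n} → X ⊑ Y → (false ∷ X) ⊑ (b ∷ Y)
  in∷_  : ∀ {n} {X Y : Subset n} → X ⊑ Y → (true ∷ X) ⊑ (true ∷ Y)

⊑-refl : ∀ {n} {X : Subset n} → X ⊑ X
⊑-refl {X = []}        = []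
⊑-refl {X = false ∷ X} = out∷ ⊑-refl
⊑-refl {X = true ∷ X}  = in∷ ⊑-refl

⊑-trans : ∀ {n} {X Y Z : Subset n} → X ⊑ Y → Y ⊑ Z → X ⊑ Z
⊑-trans []       []       = []
⊑-trans (out∷ p) (out∷ q) = out∷ ⊑-trans p q
⊑-trans (out∷ p) (in∷ q)  = out∷ ⊑-trans p q
⊑-trans (in∷ p)  (in∷ q)  = in∷ ⊑-trans p q

⊥⊑ : ∀ {n} {X : Subset n} → ⊥ ⊑ X
⊥⊑ {X = []}    = []
⊥⊑ {X = _ ∷ X} = out∷ ⊥⊑

⊑⊤ : ∀ {n} {X : Subset n} → X ⊑ ⊤
⊑⊤ {X = []}        = []
⊑⊤ {X = false ∷ X} = out∷ ⊑⊤
⊑⊤ {X = true ∷ X}  = in∷ ⊑⊤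

⊆⇒⊑ : ∀ {n} {X Y : Subset n} → X ⊆ Y → X ⊑ Y
⊆⇒⊑ {X = []}        {[]}        _   = []
⊆⇒⊑ {X = false ∷ X} {_ ∷ Y}     X⊆Y = out∷ ⊆⇒⊑ (drop-∷-⊆ X⊆Y)
⊆⇒⊑ {X = true ∷ X}  {true ∷ Y}  X⊆Y = in∷ ⊆⇒⊑ (drop-∷-⊆ X⊆Y)
⊆⇒⊑ {X = true ∷ X}  {false ∷ Y} X⊆Y with X⊆Y here
... | ()

⊑⇒⊆ : ∀ {n} {X Y : Subset n} → X ⊑ Y → X ⊆ Y
⊑⇒⊆ (in∷ p)  here      = here
⊑⇒⊆ (out∷ p) (there x) = there (⊑⇒⊆ p x)
⊑⇒⊆ (in∷ p)  (there x) = there (⊑⇒⊆ p x)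

[]≔-mono : ∀ {n} (x : Fin n) {X Y : Subset n} → X ⊑ Y → X [ x ]≔ true ⊑ Y [ x ]≔ true
[]≔-mono zero    (out∷ p) = in∷ p
[]≔-mono zero    (in∷ p)  = in∷ p
[]≔-mono (suc x) (out∷ p) = out∷ []≔-mono x p
[]≔-mono (suc x) (in∷ p)  = in∷ []≔-mono x p

⊑[]≔ : ∀ {n} (x : Fin n) (X : Subset n) → X ⊑ X [ x ]≔ true
⊑[]≔ zero    (false ∷ X) = out∷ ⊑-refl
⊑[]≔ zero    (true ∷ X)  = in∷ ⊑-refl
⊑[]≔ (suc x) (false ∷ X) = out∷ ⊑[]≔ x X
⊑[]≔ (suc x) (true ∷ X)  = in∷ ⊑[]≔ x X

[]≔-⊑ : ∀ {n} (x : Fin n) {X Y : Subset n} → lookup Y x ≡ true → X ⊑ Y → X [ x ]≔ true ⊑ Y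
[]≔-⊑ zero    refl (out∷ p) = in∷ p
[]≔-⊑ zero    refl (in∷ p)  = in∷ p
[]≔-⊑ (suc x) x∈Y  (out∷ p) = out∷ []≔-⊑ x x∈Y p
[]≔-⊑ (suc x) x∈Y  (in∷ p)  = in∷ []≔-⊑ x x∈Y p

[]≔-true : ∀ {n} (x : Fin n) {X : Subset n} → lookup X x ≡ true → X [ x ]≔ true ≡ X
[]≔-true x {X} x∈X = subst (λ b → X [ x ]≔ b ≡ X) x∈X ([]≔-lookup X x)

∣─∣-additive : ∀ {n} {X Y Z : Subset n} → X ⊑ Y → Y ⊑ Z → ∣ Y ─ X ∣ + ∣ Z ─ Y ∣ ≡ ∣ Z ─ X ∣
∣─∣-additive                 []       []       = refl
∣─∣-additive {Z = false ∷ _} (out∷ p) (out∷ q) = ∣─∣-additive p q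
∣─∣-additive {Z = true ∷ _}  (out∷ p) (out∷ q) = trans (+-suc _ _) (cong suc (∣─∣-additive p q))
∣─∣-additive                 (out∷ p) (in∷ q)  = cong suc (∣─∣-additive p q)
∣─∣-additive                 (in∷ p)  (in∷ q)  = ∣─∣-additive p q

∣─∣≡0⇒⊑ : ∀ {n} (X Y : Subset n) → ∣ X ─ Y ∣ ≡ 0 → X ⊑ Y
∣─∣≡0⇒⊑ []          []          _ = []
∣─∣≡0⇒⊑ (false ∷ X) (false ∷ Y) e = out∷ ∣─∣≡0⇒⊑ X Y e
∣─∣≡0⇒⊑ (false ∷ X) (true ∷ Y)  e = out∷ ∣─∣≡0⇒⊑ X Y e
∣─∣≡0⇒⊑ (true ∷ X)  (true ∷ Y)  e = in∷ ∣─∣≡0⇒⊑ X Y e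

∣─∣-remove : ∀ {n} (x : Fin n) (X Y : Subset n) → lookup X x ≡ true → lookup Y x ≡ false →
  ∣ X ─ Y ∣ ≡ suc ∣ X ─ Y [ x ]≔ true ∣
∣─∣-remove zero    (true ∷ X)  (false ∷ Y) refl refl = refl
∣─∣-remove (suc x) (false ∷ X) (false ∷ Y) x∈X  x∉Y  = ∣─∣-remove x X Y x∈X x∉Y
∣─∣-remove (suc x) (false ∷ X) (true ∷ Y)  x∈X  x∉Y  = ∣─∣-remove x X Y x∈X x∉Y
∣─∣-remove (suc x) (true ∷ X)  (false ∷ Y) x∈X  x∉Y  = cong suc (∣─∣-remove x X Y x∈X x∉Y)
∣─∣-remove (suc x) (true ∷ X)  (true ∷ Y)  x∈X  x∉Y  = ∣─∣-remove x X Y x∈X x∉Y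

∣─∣-insert : ∀ {n} (x : Fin n) (X Y : Subset n) → lookup X x ≡ false → lookup Y x ≡ false →
  ∣ X [ x ]≔ true ─ Y [ x ]≔ true ∣ ≡ ∣ X ─ Y ∣
∣─∣-insert zero    (false ∷ X) (false ∷ Y) refl refl = refl
∣─∣-insert (suc x) (false ∷ X) (false ∷ Y) x∉X  x∉Y  = ∣─∣-insert x X Y x∉X x∉Y
∣─∣-insert (suc x) (false ∷ X) (true ∷ Y)  x∉X  x∉Y  = ∣─∣-insert x X Y x∉X x∉Y
∣─∣-insert (suc x) (true ∷ X)  (false ∷ Y) x∉X  x∉Y  = cong suc (∣─∣-insert x X Y x∉X x∉Y)
∣─∣-insert (suc x) (true ∷ X)  (true ∷ Y)  x∉X  x∉Y  = ∣─∣-insert x X Y x∉X x∉Y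

∣⊤─⊥∣≡n : ∀ n → ∣ ⊤ {n} ─ ⊥ ∣ ≡ n
∣⊤─⊥∣≡n zero    = refl
∣⊤─⊥∣≡n (suc n) = cong suc (∣⊤─⊥∣≡n n)

∣─∣≡height : ∀ {n} {X Y : Subset n} → X ⊑ Y → ∣ Y ─ X ∣ ≡ ∣ Y ∣ ∸ ∣ X ∣
∣─∣≡height {X = X} {Y} X⊑Y = begin
  ∣ Y ─ X ∣                         ≡⟨ m+n∸m≡n ∣ X ∣ ∣ Y ─ X ∣ ⟨
  ∣ X ∣ + ∣ Y ─ X ∣ ∸ ∣ X ∣         ≡⟨ cong (λ i → i + ∣ Y ─ X ∣ ∸ ∣ X ∣) (cong ∣_∣ (p─⊥≡p X)) ⟨
  ∣ X ─ ⊥ ∣ + ∣ Y ─ X ∣ ∸ ∣ X ∣     ≡⟨ cong (_∸ ∣ X ∣) (∣─∣-additive ⊥⊑ X⊑Y) ⟩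
  ∣ Y ─ ⊥ ∣ ∸ ∣ X ∣                 ≡⟨ cong (λ Z → ∣ Z ∣ ∸ ∣ X ∣) (p─⊥≡p Y) ⟩
  ∣ Y ∣ ∸ ∣ X ∣                     ∎
  where open ≡-Reasoning

pairwise-sole : ∀ {A : Set} {R : A → A → Set} {x xs} → AllPairs R xs → x ∈ xs →
  (∀ {y} → y ∈ xs → ¬ R x y) → (∀ {y} → y ∈ xs → ¬ R y x) → xs ≡ x ∷ []
pairwise-sole (_ ∷ [])          (here refl) _    _    = refl
pairwise-sole ((Rxy ∷ _) ∷ _)   (here refl) ¬Rx∙ _    = ⊥-elim (¬Rx∙ (there (here refl)) Rxy)
pairwise-sole (Ryxs ∷ _)        (there x∈)  _    ¬R∙x = ⊥-elim (¬R∙x (here refl) (All.lookup Ryxs x∈))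

unique⇒AllPairs : ∀ {A : Set} {R : A → A → Set} {xs} → Unique xs →
  (∀ {x y} → x ∈ xs → y ∈ xs → x ≢ y → R x y) → AllPairs R xs
unique⇒AllPairs []            _ = []
unique⇒AllPairs (x≢xs ∷ uniq) R-distinct =
  All.tabulate (λ y∈xs → R-distinct (here refl) (there y∈xs) (All.lookup x≢xs y∈xs))
  ∷ unique⇒AllPairs uniq (λ x∈ y∈ → R-distinct (there x∈) (there y∈))

length-mono-⊆ : ∀ {A : Set} {xs ys : List A} → Unique xs → (∀ {x} → x ∈ xs → x ∈ ys) → length xs ≤ length ys
length-mono-⊆ {xs = []}     _             _     = z≤n
length-mono-⊆ {xs = x ∷ xs} (x∉xs ∷ uniq) xs⊆ys with ys₁ , ys₂ , refl ← ∈-∃++ (xs⊆ys (here refl)) =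
  ≤-trans (s≤s (length-mono-⊆ uniq xs⊆ys₁++ys₂)) (≤-reflexive (sym (length-++-sucʳ ys₁ x ys₂)))
  where
  xs⊆ys₁++ys₂ : ∀ {z} → z ∈ xs → z ∈ ys₁ ++ ys₂
  xs⊆ys₁++ys₂ z∈xs with ∈-++⁻ ys₁ (xs⊆ys (there z∈xs))
  ... | inj₁ z∈ys₁         = ∈-++⁺ˡ z∈ys₁
  ... | inj₂ (here z≡x)    = ⊥-elim (All.lookup x∉xs z∈xs (sym z≡x))
  ... | inj₂ (there z∈ys₂) = ∈-++⁺ʳ ys₁ z∈ys₂

length-concatMap : ∀ {A B : Set} (f : A → List B) xs → length (concatMap f xs) ≡ sumˡ (map (length ∘′ f) xs)
length-concatMap f []       = refl
length-concatMap f (x ∷ xs) = trans (length-++ (f x)) (cong (length (f x) +_) (length-concatMap f xs))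

sum-mono-≤ : ∀ {n} {f g : Fin n → ℕ} → (∀ x → f x ≤ g x) → sum f ≤ sum g
sum-mono-≤ {zero}  f≤g = z≤n
sum-mono-≤ {suc n} f≤g = +-mono-≤ (f≤g zero) (sum-mono-≤ (λ x → f≤g (suc x)))

sum-outside : ∀ {n} (S : Subset n) c → ∑[ x < n ] (if lookup S x then 0 else c) ≡ ∣ ⊤ ─ S ∣ * c
sum-outside []          c = refl
sum-outside (false ∷ S) c = cong (c +_) (sum-outside S c)
sum-outside (true ∷ S)  c = sum-outside S c

module _ {A : Set} where

  sumˡ-map-cong : ∀ {P : A → Set} {f g : A → ℕ} {xs} → All P xs →
    (∀ {x} → P x → f x ≡ g x) → sumˡ (map f xs) ≡ sumˡ (map g xs)
  sumˡ-map-cong []         f≡g = refl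
  sumˡ-map-cong (px ∷ pxs) f≡g = cong₂ _+_ (f≡g px) (sumˡ-map-cong pxs f≡g)

  sumˡ-map-mono : ∀ {P : A → Set} {f g : A → ℕ} {xs} → All P xs →
    (∀ {x} → P x → f x ≤ g x) → sumˡ (map f xs) ≤ sumˡ (map g xs)
  sumˡ-map-mono []         f≤g = z≤n
  sumˡ-map-mono (px ∷ pxs) f≤g = +-mono-≤ (f≤g px) (sumˡ-map-mono pxs f≤g)

  *-sumˡ-map : ∀ c (f : A → ℕ) xs → c * sumˡ (map f xs) ≡ sumˡ (map (λ x → c * f x) xs)
  *-sumˡ-map c f []       = *-zeroʳ c
  *-sumˡ-map c f (x ∷ xs) = trans (*-distribˡ-+ c (f x) _) (cong (c * f x +_) (*-sumˡ-map c f xs))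

  sumˡ-map-* : ∀ (f : A → ℕ) c xs → sumˡ (map f xs) * c ≡ sumˡ (map (λ x → f x * c) xs)
  sumˡ-map-* f c []       = refl
  sumˡ-map-* f c (x ∷ xs) = trans (*-distribʳ-+ c (f x) _) (cong (f x * c +_) (sumˡ-map-* f c xs))

  sumˡ-map-if : ∀ b (f : A → ℕ) xs →
    sumˡ (map (λ x → if b then 0 else f x) xs) ≡ (if b then 0 else sumˡ (map f xs))
  sumˡ-map-if false f xs       = refl
  sumˡ-map-if true  f []       = refl
  sumˡ-map-if true  f (x ∷ xs) = sumˡ-map-if true f xs

  sumˡ-sum-comm : ∀ {n} (f : A → Fin n → ℕ) xs →
    sumˡ (map (λ a → ∑[ i < n ] f a i) xs) ≡ ∑[ i < n ] sumˡ (map (λ a → f a i) xs)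
  sumˡ-sum-comm {n} f []       = sym (sum-replicate-zero n)
  sumˡ-sum-comm {n} f (x ∷ xs) =
    trans (cong (sum (f x) +_) (sumˡ-sum-comm f xs)) (sym (∑-distrib-+ (f x) _))

between : ∀ {n} → Subset n → Subset n → List (Subset n)
between []          []          = [] ∷ []
between (false ∷ A) (false ∷ B) = map (false ∷_) (between A B)
between (false ∷ A) (true ∷ B)  = map (false ∷_) (between A B) ++ map (true ∷_) (between A B)
between (true ∷ A)  (false ∷ B) = []
between (true ∷ A)  (true ∷ B)  = map (true ∷_) (between A B)

length-between : ∀ {n} {A B : Subset n} → A ⊑ B → length (between A B) ≡ 2 ^ ∣ B ─ A ∣
length-between [] = refl
length-between {A = _ ∷ A} {false ∷ B} (out∷ A⊑B) =
  trans (length-map (false ∷_) (between A B)) (length-between A⊑B)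
length-between {A = _ ∷ A} {true ∷ B} (out∷ A⊑B) = begin
  length (map (false ∷_) (between A B) ++ map (true ∷_) (between A B))
    ≡⟨ length-++ (map (false ∷_) (between A B)) ⟩
  length (map (false ∷_) (between A B)) + length (map (true ∷_) (between A B))
    ≡⟨ cong₂ _+_ (length-map (false ∷_) (between A B)) (length-map (true ∷_) (between A B)) ⟩
  length (between A B) + length (between A B)
    ≡⟨ cong (λ l → l + l) (length-between A⊑B) ⟩
  2 ^ ∣ B ─ A ∣ + 2 ^ ∣ B ─ A ∣
    ≡⟨ cong (2 ^ ∣ B ─ A ∣ +_) (+-identityʳ (2 ^ ∣ B ─ A ∣)) ⟨
  2 ^ suc ∣ B ─ A ∣ ∎
  where open ≡-Reasoning
length-between {A = _ ∷ A} {_ ∷ B} (in∷ A⊑B) =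
  trans (length-map (true ∷_) (between A B)) (length-between A⊑B)

∈-between : ∀ {n} {A X B : Subset n} → A ⊑ X → X ⊑ B → X ∈ between A B
∈-between [] [] = here refl
∈-between {B = false ∷ _} (out∷ A⊑X) (out∷ X⊑B) = ∈-map⁺ (false ∷_) (∈-between A⊑X X⊑B)
∈-between {B = true ∷ _}  (out∷ A⊑X) (out∷ X⊑B) = ∈-++⁺ˡ (∈-map⁺ (false ∷_) (∈-between A⊑X X⊑B))
∈-between {A = _ ∷ A} {B = _ ∷ B} (out∷ A⊑X) (in∷ X⊑B) =
  ∈-++⁺ʳ (map (false ∷_) (between A B)) (∈-map⁺ (true ∷_) (∈-between A⊑X X⊑B))
∈-between (in∷ A⊑X) (in∷ X⊑B) = ∈-map⁺ (true ∷_) (∈-between A⊑X X⊑B)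

sum-layers : ∀ {n} α β {S A B : Subset n} → S ⊑ A → A ⊑ B →
  ∑[ x < n ] (if lookup S x then 0 else if lookup B x then (if lookup A x then α else β) else 0)
    ≡ ∣ A ─ S ∣ * α + ∣ B ─ A ∣ * β
sum-layers α β [] [] = refl
sum-layers α β {B = false ∷ _} (out∷ p) (out∷ q) = sum-layers α β p q
sum-layers α β {_ ∷ S} {_ ∷ A} {true ∷ B} (out∷ p) (out∷ q) =
  trans (cong (β +_) (sum-layers α β p q)) (m+[n+o]≡n+[m+o] β (∣ A ─ S ∣ * α) (∣ B ─ A ∣ * β))
sum-layers α β {_ ∷ S} {_ ∷ A} {_ ∷ B} (out∷ p) (in∷ q) =
  trans (cong (α +_) (sum-layers α β p q)) (sym (+-assoc α (∣ A ─ S ∣ * α) (∣ B ─ A ∣ * β)))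
sum-layers α β (in∷ p) (in∷ q) = sum-layers α β p q

Diamond : ℕ → Set
Diamond n = Subset n × Subset n

module Diamonds {n : ℕ} where

  Above : Subset n → Diamond n → Set
  Above S (A , B) = S ⊑ A × A ⊑ B

  -- No member of one diamond is contained in a member of the other, so no chain meets both.
  Separated : Diamond n → Diamond n → Set
  Separated (A , B) (A′ , B′) = ¬ A ⊑ B′ × ¬ A′ ⊑ B

  -- The number of maximal chains from S to ⊤ that meet the diamond.
  weight : Subset n → Diamond n → ℕ
  weight S (A , B) = meetingChains (∣ ⊤ ─ S ∣) (∣ A ─ S ∣) (∣ B ─ A ∣)

  -- A chain from S whose first new element is x meets [A, B] iff it meets [A ∪ {x}, B],
  -- and it cannot meet [A, B] at all if x ∉ B.
  weightAbove : Subset n → Fin n → Diamond n → ℕ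
  weightAbove S x (A , B) = if lookup B x then weight (S [ x ]≔ true) (A [ x ]≔ true , B) else 0

  weight-split : ∀ {m a S A B} → ∣ ⊤ ─ S ∣ ≡ suc m → ∣ A ─ S ∣ ≡ suc a → S ⊑ A → A ⊑ B →
    weight S (A , B) ≡ ∑[ x < n ] (if lookup S x then 0 else weightAbove S x (A , B))
  weight-split {m} {a} {S} {A} {B} ∣⊤─S∣≡1+m ∣A─S∣≡1+a S⊑A A⊑B = begin
    meetingChains (∣ ⊤ ─ S ∣) (∣ A ─ S ∣) h
      ≡⟨ cong₂ (λ i j → meetingChains i j h) ∣⊤─S∣≡1+m ∣A─S∣≡1+a ⟩
    suc a * α + h * β
      ≡⟨ cong (λ i → i * α + h * β) ∣A─S∣≡1+a ⟨
    ∣ A ─ S ∣ * α + h * β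
      ≡⟨ sum-layers α β S⊑A A⊑B ⟨
    ∑[ x < n ] (if lookup S x then 0 else if lookup B x then (if lookup A x then α else β) else 0)
      ≡⟨ sum-cong-≗ layer ⟩
    ∑[ x < n ] (if lookup S x then 0 else weightAbove S x (A , B)) ∎
    where
    open ≡-Reasoning
    h = ∣ B ─ A ∣
    α = meetingChains m a h
    β = meetingChains m (suc a) (pred h)
    ∣⊤─S+x∣≡m : ∀ {x} → lookup S x ≡ false → ∣ ⊤ ─ S [ x ]≔ true ∣ ≡ m
    ∣⊤─S+x∣≡m {x} x∉S = suc-injective (trans (sym (∣─∣-remove x ⊤ S (lookup-replicate x true) x∉S)) ∣⊤─S∣≡1+m)
    layer : ∀ x → (if lookup S x then 0 else if lookup B x then (if lookup A x then α else β) else 0)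
                ≡ (if lookup S x then 0 else weightAbove S x (A , B))
    layer x with lookup S x in Sx | lookup B x in Bx | lookup A x in Ax
    ... | true  | _     | _     = refl
    ... | false | false | _     = refl
    ... | false | true  | true  =
      sym (meetingChains-cong (∣⊤─S+x∣≡m Sx) ∣A─S+x∣≡a (cong (λ A′ → ∣ B ─ A′ ∣) ([]≔-true x {A} Ax)))
      where
      ∣A─S+x∣≡a : ∣ A [ x ]≔ true ─ S [ x ]≔ true ∣ ≡ a
      ∣A─S+x∣≡a = begin
        ∣ A [ x ]≔ true ─ S [ x ]≔ true ∣ ≡⟨ cong (λ A′ → ∣ A′ ─ S [ x ]≔ true ∣) ([]≔-true x {A} Ax) ⟩
        ∣ A ─ S [ x ]≔ true ∣             ≡⟨ suc-injective (trans (sym (∣─∣-remove x A S Ax Sx)) ∣A─S∣≡1+a) ⟩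
        a                                 ∎
    ... | false | true  | false =
      sym (meetingChains-cong (∣⊤─S+x∣≡m Sx) (trans (∣─∣-insert x A S Ax Sx) ∣A─S∣≡1+a)
                              (cong pred (sym (∣─∣-remove x B A Bx Ax))))

  restrictAbove : Fin n → List (Diamond n) → List (Diamond n)
  restrictAbove x []            = []
  restrictAbove x ((A , B) ∷ L) with lookup B x
  ... | true  = (A [ x ]≔ true , B) ∷ restrictAbove x L
  ... | false = restrictAbove x L

  sum-weightAbove : ∀ S x L → sumˡ (map (weightAbove S x) L) ≡ sumˡ (map (weight (S [ x ]≔ true)) (restrictAbove x L))
  sum-weightAbove S x []            = refl
  sum-weightAbove S x ((A , B) ∷ L) with lookup B x
  ... | true  = cong (weight (S [ x ]≔ true) (A [ x ]≔ true , B) +_) (sum-weightAbove S x L)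
  ... | false = sum-weightAbove S x L

  restrictAbove-Above : ∀ {S} x {L} → All (Above S) L → All (Above (S [ x ]≔ true)) (restrictAbove x L)
  restrictAbove-Above x []                                    = []
  restrictAbove-Above x {(A , B) ∷ L} ((S⊑A , A⊑B) ∷ above) with lookup B x in x∈B
  ... | true  = ([]≔-mono x S⊑A , []≔-⊑ x x∈B A⊑B) ∷ restrictAbove-Above x above
  ... | false = restrictAbove-Above x above

  restrictAbove-Separated : ∀ x {L} → AllPairs Separated L → AllPairs Separated (restrictAbove x L)
  restrictAbove-Separated x {[]}          []           = []
  restrictAbove-Separated x {(A , B) ∷ L} (sep ∷ seps) with lookup B x
  ... | true  = separated L sep ∷ restrictAbove-Separated x seps
    where
    separated : ∀ L → All (Separated (A , B)) L → All (Separated (A [ x ]≔ true , B)) (restrictAbove x L)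
    separated []              []                  = []
    separated ((A′ , B′) ∷ L) ((A⋢B′ , A′⋢B) ∷ sep) with lookup B′ x
    ... | true  = ((λ A+x⊑B′ → A⋢B′ (⊑-trans (⊑[]≔ x A) A+x⊑B′)) , (λ A′+x⊑B → A′⋢B (⊑-trans (⊑[]≔ x A′) A′+x⊑B)))
                  ∷ separated L sep
    ... | false = separated L sep
  ... | false = restrictAbove-Separated x seps

  BottomAt : Subset n → Diamond n → Set
  BottomAt S (A , B) = ∣ A ─ S ∣ ≡ 0

  -- Every chain from S meets a diamond with bottom S, so separation leaves it alone in L.
  sum-weight-with-bottom-at : ∀ {S L D} → D ∈ L → BottomAt S D → All (Above S) L → AllPairs Separated L →
    sumˡ (map (weight S) L) ≡ ∣ ⊤ ─ S ∣ !
  sum-weight-with-bottom-at {S} {L} {A , B} D∈L ∣A─S∣≡0 above seps = begin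
    sumˡ (map (weight S) L)
      ≡⟨ cong (sumˡ ∘′ map (weight S)) (pairwise-sole seps D∈L (λ E∈L sep → proj₁ sep (below E∈L))
                                                             (λ E∈L sep → proj₂ sep (below E∈L))) ⟩
    weight S (A , B) + 0
      ≡⟨ +-identityʳ _ ⟩
    meetingChains (∣ ⊤ ─ S ∣) (∣ A ─ S ∣) (∣ B ─ A ∣)
      ≡⟨ cong (λ a → meetingChains (∣ ⊤ ─ S ∣) a (∣ B ─ A ∣)) ∣A─S∣≡0 ⟩
    ∣ ⊤ ─ S ∣ ! ∎
    where
    open ≡-Reasoning
    below : ∀ {E} → E ∈ L → A ⊑ proj₂ E
    below E∈L with All.lookup above E∈L
    ... | S⊑A′ , A′⊑B′ = ⊑-trans (∣─∣≡0⇒⊑ A S ∣A─S∣≡0) (⊑-trans S⊑A′ A′⊑B′)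

  sum-weight-at-top : ∀ {S L} → ∣ ⊤ ─ S ∣ ≡ 0 → All (Above S) L → All (¬_ ∘′ BottomAt S) L →
    sumˡ (map (weight S) L) ≡ 0
  sum-weight-at-top _        []                  []       = refl
  sum-weight-at-top ∣⊤─S∣≡0 ((S⊑A , _) ∷ _) (A≠S ∷ _) =
    ⊥-elim (A≠S (m+n≡0⇒m≡0 _ (trans (∣─∣-additive S⊑A ⊑⊤) ∣⊤─S∣≡0)))

  LYMBound : ℕ → Set
  LYMBound m = ∀ {S L} → ∣ ⊤ ─ S ∣ ≡ m → All (Above S) L → AllPairs Separated L → sumˡ (map (weight S) L) ≤ m !

  sum-weight-step : ∀ {m} → LYMBound m → ∀ {S L} → ∣ ⊤ ─ S ∣ ≡ suc m →
    All (Above S) L → AllPairs Separated L → All (¬_ ∘′ BottomAt S) L → sumˡ (map (weight S) L) ≤ suc m !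
  sum-weight-step {m} lym-m {S} {L} ∣⊤─S∣≡1+m above seps notBottom = begin
    sumˡ (map (weight S) L)
      ≡⟨ sumˡ-map-cong (All.zip (above , notBottom)) split ⟩
    sumˡ (map (λ D → ∑[ x < n ] (if lookup S x then 0 else weightAbove S x D)) L)
      ≡⟨ sumˡ-sum-comm (λ D x → if lookup S x then 0 else weightAbove S x D) L ⟩
    ∑[ x < n ] sumˡ (map (λ D → if lookup S x then 0 else weightAbove S x D) L)
      ≡⟨ sum-cong-≗ (λ x → trans (sumˡ-map-if (lookup S x) (weightAbove S x) L)
                                 (cong (if lookup S x then 0 else_) (sum-weightAbove S x L))) ⟩
    ∑[ x < n ] (if lookup S x then 0 else sumˡ (map (weight (S [ x ]≔ true)) (restrictAbove x L)))
      ≤⟨ sum-mono-≤ restricted≤ ⟩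
    ∑[ x < n ] (if lookup S x then 0 else m !)
      ≡⟨ sum-outside S (m !) ⟩
    ∣ ⊤ ─ S ∣ * m !
      ≡⟨ cong (_* m !) ∣⊤─S∣≡1+m ⟩
    suc m ! ∎
    where
    open ≤-Reasoning
    split : ∀ {D} → Above S D × ¬ BottomAt S D →
      weight S D ≡ ∑[ x < n ] (if lookup S x then 0 else weightAbove S x D)
    split {A , B} ((S⊑A , A⊑B) , A≠S) =
      weight-split ∣⊤─S∣≡1+m (sym (suc-pred (∣ A ─ S ∣) {{≢-nonZero A≠S}})) S⊑A A⊑B
    restricted≤ : ∀ x → (if lookup S x then 0 else sumˡ (map (weight (S [ x ]≔ true)) (restrictAbove x L)))
                      ≤ (if lookup S x then 0 else m !)
    restricted≤ x with lookup S x in x∉S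
    ... | true  = z≤n
    ... | false = lym-m (suc-injective (trans (sym (∣─∣-remove x ⊤ S (lookup-replicate x true) x∉S)) ∣⊤─S∣≡1+m))
                        (restrictAbove-Above x above) (restrictAbove-Separated x seps)

  lym : ∀ m → LYMBound m
  lym m {S} {L} ∣⊤─S∣≡m above seps with any? (λ D → ∣ proj₁ D ─ S ∣ ≟ 0) L
  ... | yes bottomAt = let _ , D∈L , atBottom = find bottomAt in
    ≤-reflexive (trans (sum-weight-with-bottom-at D∈L atBottom above seps) (cong _! ∣⊤─S∣≡m))
  ... | no  ¬bottomAt with m
  ...   | zero   = ≤-trans (≤-reflexive (sum-weight-at-top ∣⊤─S∣≡m above (¬Any⇒All¬ L ¬bottomAt))) z≤n
  ...   | suc m′ = sum-weight-step (lym m′) ∣⊤─S∣≡m above seps (¬Any⇒All¬ L ¬bottomAt)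

  Height≤ : ℕ → Diamond n → Set
  Height≤ k (A , B) = A ⊑ B × ∣ B ─ A ∣ ≤ k

  2^height*n!≤bound*weight : ∀ {k A B} → k ≤ n → Height≤ k (A , B) →
    2 ^ ∣ B ─ A ∣ * n ! ≤ 2 ^ k * central (n ∸ k) * weight ⊥ (A , B)
  2^height*n!≤bound*weight {k} {A} {B} k≤n (A⊑B , h≤k) =
    subst (λ m → 2 ^ ∣ B ─ A ∣ * n ! ≤ 2 ^ k * central (n ∸ k) * meetingChains m (∣ A ─ ⊥ ∣) (∣ B ─ A ∣))
          (sym (∣⊤─⊥∣≡n n)) (2^h*m!≤bound*meetingChains a+h≤n h≤k k≤n)
    where
    open ≤-Reasoning
    a+h≤n : ∣ A ─ ⊥ ∣ + ∣ B ─ A ∣ ≤ n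
    a+h≤n = begin
      ∣ A ─ ⊥ ∣ + ∣ B ─ A ∣ ≡⟨ ∣─∣-additive ⊥⊑ A⊑B ⟩
      ∣ B ─ ⊥ ∣             ≤⟨ m≤m+n (∣ B ─ ⊥ ∣) (∣ ⊤ ─ B ∣) ⟩
      ∣ B ─ ⊥ ∣ + ∣ ⊤ ─ B ∣ ≡⟨ ∣─∣-additive (⊥⊑ {X = B}) ⊑⊤ ⟩
      ∣ ⊤ {n} ─ ⊥ ∣         ≡⟨ ∣⊤─⊥∣≡n n ⟩
      n                     ∎

  separated-diamonds-size : ∀ {k L} → k ≤ n → All (Height≤ k) L → AllPairs Separated L →
    length (concatMap (uncurry between) L) ≤ 2 ^ k * central (n ∸ k)
  separated-diamonds-size {k} {L} k≤n heights seps = *-cancelʳ-≤ _ _ (n !) {{n !≢0}} (begin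
    length (concatMap (uncurry between) L) * n !
      ≡⟨ cong (_* n !) (length-concatMap (uncurry between) L) ⟩
    sumˡ (map (length ∘′ uncurry between) L) * n !
      ≡⟨ sumˡ-map-* (length ∘′ uncurry between) (n !) L ⟩
    sumˡ (map (λ D → length (uncurry between D) * n !) L)
      ≤⟨ sumˡ-map-mono heights size≤ ⟩
    sumˡ (map (λ D → bound * weight ⊥ D) L)
      ≡⟨ *-sumˡ-map bound (weight ⊥) L ⟨
    bound * sumˡ (map (weight ⊥) L)
      ≤⟨ *-monoʳ-≤ bound (lym n (∣⊤─⊥∣≡n n) (All.map (λ (A⊑B , _) → ⊥⊑ , A⊑B) heights) seps) ⟩
    bound * n ! ∎)
    where
    open ≤-Reasoning
    bound = 2 ^ k * central (n ∸ k)
    size≤ : ∀ {D} → Height≤ k D → length (uncurry between D) * n ! ≤ bound * weight ⊥ D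
    size≤ {A , B} (A⊑B , h≤k) =
      subst (λ l → l * n ! ≤ bound * weight ⊥ (A , B)) (sym (length-between A⊑B))
            (2^height*n!≤bound*weight k≤n (A⊑B , h≤k))

module _ {n : ℕ} {F : List (Subset n)} where

  Connected-sym : ∀ {X Y} → Connected F X Y → Connected F Y X
  Connected-sym = reverse λ where (adj X∈F Y∈F X≢Y X⊆Y⊎Y⊆X) → adj Y∈F X∈F (X≢Y ∘′ sym) (Sum.swap X⊆Y⊎Y⊆X)

  ⊆⇒Connected : ∀ {X Y} → X ∈ F → Y ∈ F → X ⊆ Y → Connected F X Y
  ⊆⇒Connected {X} {Y} X∈F Y∈F X⊆Y with Vec.≡-dec Bool._≟_ X Y
  ... | yes refl = ε
  ... | no  X≢Y  = adj X∈F Y∈F X≢Y (inj₁ X⊆Y) ◅ ε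

InDiamond-injective : ∀ {n} {A B A′ B′ : Subset n} → A ⊆ B → A′ ⊆ B′ →
  (∀ X → InDiamond A B X → InDiamond A′ B′ X) → (∀ X → InDiamond A′ B′ X → InDiamond A B X) →
  (A , B) ≡ (A′ , B′)
InDiamond-injective {A = A} {B} {A′} {B′} A⊆B A′⊆B′ into back = cong₂ _,_
  (⊆-antisym (proj₁ (back A′ (⊆-refl , A′⊆B′))) (proj₁ (into A (⊆-refl , A⊆B))))
  (⊆-antisym (proj₂ (into B (A⊆B , ⊆-refl))) (proj₂ (back B′ (A′⊆B′ , ⊆-refl))))

module Components {n k : ℕ} {F : List (Subset n)}
                  (component : (C : Subset n) → C ∈ F → ComponentIsDiamond k F C) where

  open Diamonds {n}

  bottom top : ∀ {X} → X ∈ F → Subset n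
  bottom {X} X∈F = proj₁ (component X X∈F)
  top    {X} X∈F = proj₁ (proj₂ (component X X∈F))

  bottom⊆top : ∀ {X} (X∈F : X ∈ F) → bottom X∈F ⊆ top X∈F
  bottom⊆top {X} X∈F = proj₁ (proj₂ (proj₂ (component X X∈F)))

  height≤k : ∀ {X} (X∈F : X ∈ F) → height (bottom X∈F) (top X∈F) ≤ k
  height≤k {X} X∈F = proj₁ (proj₂ (proj₂ (proj₂ (component X X∈F))))

  component⇔diamond : ∀ {X} (X∈F : X ∈ F) Z →
    (Z ∈ F × Connected F X Z) ⇔ InDiamond (bottom X∈F) (top X∈F) Z
  component⇔diamond {X} X∈F = proj₂ (proj₂ (proj₂ (proj₂ (component X X∈F))))

  diamondOf : ∀ {X} → X ∈ F → Diamond n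
  diamondOf X∈F = bottom X∈F , top X∈F

  diamondOf-Connected : ∀ {X Y} (X∈F : X ∈ F) (Y∈F : Y ∈ F) →
    Connected F X Y → diamondOf X∈F ≡ diamondOf Y∈F
  diamondOf-Connected X∈F Y∈F X~Y =
    InDiamond-injective (bottom⊆top X∈F) (bottom⊆top Y∈F) (move X∈F Y∈F X~Y) (move Y∈F X∈F (Connected-sym X~Y))
    where
    move : ∀ {X Y} (X∈F : X ∈ F) (Y∈F : Y ∈ F) → Connected F X Y →
      ∀ Z → InDiamond (bottom X∈F) (top X∈F) Z → InDiamond (bottom Y∈F) (top Y∈F) Z
    move X∈F Y∈F X~Y Z Z∈D = let Z∈F , X~Z = Equivalence.from (component⇔diamond X∈F Z) Z∈D in
      Equivalence.to (component⇔diamond Y∈F Z) (Z∈F , Connected-sym X~Y ◅◅ X~Z)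

  bottom⊆top⇒diamondOf≡ : ∀ {X Y} (X∈F : X ∈ F) (Y∈F : Y ∈ F) →
    bottom X∈F ⊆ top Y∈F → diamondOf X∈F ≡ diamondOf Y∈F
  bottom⊆top⇒diamondOf≡ X∈F Y∈F A⊆B′ =
    let A∈F  , X~A  = Equivalence.from (component⇔diamond X∈F (bottom X∈F)) (⊆-refl , bottom⊆top X∈F)
        B′∈F , Y~B′ = Equivalence.from (component⇔diamond Y∈F (top Y∈F)) (bottom⊆top Y∈F , ⊆-refl)
    in  diamondOf-Connected X∈F Y∈F (X~A ◅◅ ⊆⇒Connected A∈F B′∈F A⊆B′ ◅◅ Connected-sym Y~B′)

  _≟ᴰ_ : DecidableEquality (Diamond n)
  _≟ᴰ_ = Product.≡-dec (Vec.≡-dec Bool._≟_) (Vec.≡-dec Bool._≟_)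

  diamonds : List (Diamond n)
  diamonds = deduplicate _≟ᴰ_ (mapWith∈ F diamondOf)

  ∈-diamonds⁻ : ∀ {D} → D ∈ diamonds → ∃₂ λ X (X∈F : X ∈ F) → D ≡ diamondOf X∈F
  ∈-diamonds⁻ D∈ = mapWith∈⁻ F diamondOf (∈-deduplicate⁻ _≟ᴰ_ (mapWith∈ F diamondOf) D∈)

  diamondOf∈diamonds : ∀ {X} (X∈F : X ∈ F) → diamondOf X∈F ∈ diamonds
  diamondOf∈diamonds X∈F = ∈-deduplicate⁺ _≟ᴰ_ (mapWith∈⁺ diamondOf (_ , X∈F , refl))

  diamonds-Height≤ : All (Height≤ k) diamonds
  diamonds-Height≤ = All.tabulate λ D∈ → Height≤-diamondOf (∈-diamonds⁻ D∈)
    where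
    Height≤-diamondOf : ∀ {D} → ∃₂ (λ X (X∈F : X ∈ F) → D ≡ diamondOf X∈F) → Height≤ k D
    Height≤-diamondOf (_ , X∈F , refl) =
      ⊆⇒⊑ (bottom⊆top X∈F) , subst (_≤ k) (sym (∣─∣≡height (⊆⇒⊑ (bottom⊆top X∈F)))) (height≤k X∈F)

  diamonds-Separated : AllPairs Separated diamonds
  diamonds-Separated = unique⇒AllPairs (deduplicate-! _≟ᴰ_ (mapWith∈ F diamondOf)) separated
    where
    separated : ∀ {D E} → D ∈ diamonds → E ∈ diamonds → D ≢ E → Separated D E
    separated D∈ E∈ D≢E with ∈-diamonds⁻ D∈ | ∈-diamonds⁻ E∈
    ... | _ , X∈F , refl | _ , Y∈F , refl =
      (λ A⊑B′ → D≢E (bottom⊆top⇒diamondOf≡ X∈F Y∈F (⊑⇒⊆ A⊑B′))) ,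
      (λ A′⊑B → D≢E (sym (bottom⊆top⇒diamondOf≡ Y∈F X∈F (⊑⇒⊆ A′⊑B))))

  ∈-diamonds-members : ∀ {X} → X ∈ F → X ∈ concatMap (uncurry between) diamonds
  ∈-diamonds-members X∈F =
    let A⊆X , X⊆B = Equivalence.to (component⇔diamond X∈F _) (X∈F , ε)
    in  ∈-concatMap⁺ (uncurry between) (lose (diamondOf∈diamonds X∈F) (∈-between (⊆⇒⊑ A⊆X) (⊆⇒⊑ X⊆B)))

theorem3p2 : (k n : ℕ) → k ≤ n → (F : List (Subset n)) → Unique F →
    ((C : Subset n) → C ∈ F → ComponentIsDiamond k F C) →
    length F ≤ 2 ^ k * ((n ∸ k) C ((n ∸ k) / 2))
theorem3p2 k n k≤n F unique component =
  subst (λ c → length F ≤ 2 ^ k * c) (binomial≡C (n ∸ k) ((n ∸ k) / 2)) (begin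
    length F                                      ≤⟨ length-mono-⊆ unique ∈-diamonds-members ⟩
    length (concatMap (uncurry between) diamonds) ≤⟨ separated-diamonds-size k≤n diamonds-Height≤ diamonds-Separated ⟩
    2 ^ k * central (n ∸ k)                       ∎)
  where
  open Components component
  open Diamonds
  open ≤-Reasoning
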